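{- Let $\mathcal G=\langle n;E\rangle$ be a simple connected graph with vertex set $n=\{0,1,\ldots,n-1\}$ and edge set $E$. Suppose $n$ is the disjoint union of $V_0$ and $V_1$, let $C\subseteq E$ be the set of edges having one endpoint in $V_0$ and the other in $V_1$, and let $\mathcal G_0=\langle V_0;E_0\rangle$ and $\mathcal G_1=\langle V_1;E_1\rangle$ be the subgraphs with $E_i$ the set of edges of $\mathcal G$ with both endpoints in $V_i$ (so $E=E_0\cup C\cup E_1$). Suppose $\mathcal G_0$ is a forest, $2|C|<|V_0|$, and $|V_1|\ge 2$. Then $\mathcal G$ is not perm-complete.
   Context: Permutations in $\mathrm{Sym}(n)$ compose left to right. For a finite sequence $\mathbf s$ in $\mathrm{Sym}(n)$, $\bigcirc\mathbf s$ is the composite of its terms in order, $\mathrm{Seq}(\mathbf s)$ the set of its rearrangements and $\mathrm{Prod}(\mathbf s)=\{\bigcirc\mathbf r:\mathbf r\in\mathrm{Seq}(\mathbf s)\}$; $\mathbf s$ is perm-complete iff $\mathrm{Prod}(\mathbf s)$ is $\mathrm{Alt}(n)$ or $\mathrm{Sym}(n)\setminus\mathrm{Alt}(n)$. A simple graph on vertex set $n$ is perm-complete iff the sequence listing each of its edges $(x\,y)$ exactly once as the transposition $(x\,y)\in\mathrm{Sym}(n)$ is perm-complete (equivalently, it is isomorphic to such a graph; the order of listing is irrelevant). -}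

module Defs where

open import Data.Nat using (ℕ; _≤_; _<_; _%_; zero; suc)
open import Data.Fin as Fin using (Fin)
open import Data.Fin.Subset using (Subset; _∈_; _∉_; ∁; ∣_∣)
open import Data.Fin.Subset.Properties using (_∈?_)
open import Data.Fin.Permutation using (Permutation′; _∘ₚ_; id; transpose; _≈_; _⟨$⟩ʳ_)
open import Data.List using (List; []; _∷_; _∷ʳ_; length; map; foldr; filter; allFin; cartesianProduct)
open import Data.List.Membership.Propositional using () renaming (_∈_ to _∈ₗ_)
open import Data.List.Relation.Unary.All using (All)
open import Data.List.Relation.Unary.Unique.Propositional using (Unique)
open import Data.List.Relation.Unary.Linked using (Linked)
open import Data.List.Relation.Binary.Permutation.Propositional using (_↭_)
open import Data.Product using (_×_; _,_; ∃; proj₁; proj₂)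
open import Data.Sum using (_⊎_)
open import Relation.Nullary using (¬_)
open import Relation.Nullary.Decidable using (_×-dec_; _⊎-dec_; ¬?)
open import Relation.Binary.PropositionalEquality using (_≡_)
open import Relation.Binary.Construct.Closure.ReflexiveTransitive using (Star)

-- Permutations of n = Fin n (stdlib Permutation′ n); π ∘ₚ ρ applies π
-- first, then ρ, i.e. composition is left to right as in the paper.

○ : {n : ℕ} → List (Permutation′ n) → Permutation′ n
○ = foldr _∘ₚ_ id

InProd : {n : ℕ} → List (Permutation′ n) → Permutation′ n → Set
InProd s π = ∃ λ r → (r ↭ s) × (○ r ≈ π)

inversions : {n : ℕ} → Permutation′ n → ℕ
inversions {n} π =
  length (filter (λ p → (proj₁ p Fin.<? proj₂ p) ×-dec (π ⟨$⟩ʳ proj₂ p Fin.<? π ⟨$⟩ʳ proj₁ p))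
                 (cartesianProduct (allFin n) (allFin n)))

InAlt : {n : ℕ} → Permutation′ n → Set
InAlt π = inversions π % 2 ≡ 0

PermComplete : {n : ℕ} → List (Permutation′ n) → Set
PermComplete {n} s =
    (∀ (π : Permutation′ n) → (InProd s π → InAlt π) × (InAlt π → InProd s π))
  ⊎ (∀ (π : Permutation′ n) → (InProd s π → ¬ InAlt π) × (¬ InAlt π → InProd s π))

-- Simple graphs on vertex set n, given by their edge list: each edge
-- {x,y} is stored once as (x , y) with x < y, without repetition.

Edge : ℕ → Set
Edge n = Fin n × Fin n

SimpleGraph : {n : ℕ} → List (Edge n) → Set
SimpleGraph E = All (λ e → proj₁ e Fin.< proj₂ e) E × Unique E

edgePerm : {n : ℕ} → Edge n → Permutation′ n
edgePerm e = transpose (proj₁ e) (proj₂ e)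

PermCompleteGraph : {n : ℕ} → List (Edge n) → Set
PermCompleteGraph E = PermComplete (map edgePerm E)

Adj : {n : ℕ} → List (Edge n) → Fin n → Fin n → Set
Adj E x y = ((x , y) ∈ₗ E) ⊎ ((y , x) ∈ₗ E)

Connected : {n : ℕ} → List (Edge n) → Set
Connected E = ∀ x y → Star (Adj E) x y

-- A cycle: distinct vertices x, v₁, …, v_k (k ≥ 2, so ≥ 3 vertices) with
-- consecutive ones adjacent and v_k adjacent to x.
Cycle : {n : ℕ} → List (Edge n) → Fin n → List (Fin n) → Set
Cycle E x vs = (2 ≤ length vs) × Unique (x ∷ vs) × Linked (Adj E) ((x ∷ vs) ∷ʳ x)

Forest : {n : ℕ} → List (Edge n) → Set
Forest E = ∀ x vs → ¬ Cycle E x vs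

-- Partition n = V₀ ⊔ V₁ with V₁ = ∁ V₀.

crossEdges : {n : ℕ} → Subset n → List (Edge n) → List (Edge n)
crossEdges V₀ = filter (λ e → ((proj₁ e ∈? V₀) ×-dec ¬? (proj₂ e ∈? V₀))
                            ⊎-dec (¬? (proj₁ e ∈? V₀) ×-dec (proj₂ e ∈? V₀)))

inducedEdges : {n : ℕ} → Subset n → List (Edge n) → List (Edge n)
inducedEdges V = filter (λ e → (proj₁ e ∈? V) ×-dec (proj₂ e ∈? V))

module Submission where

-- Prod(E) consists either of all even or of all odd permutations.  Take b ∈ V₁ and a
-- neighbour c = b ± 1: the identity (even) and the transposition (b c) (odd) both fix every
-- vertex of V₀ other than c, so it suffices that no product of a rearrangement L of E does.
-- Follow a vertex w ∈ V₀ through such a product: the edges that move it form its trail, and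
-- w escapes if its trail uses an edge of C.  When an edge of C acts it lets at most one
-- vertex of V₀ escape, so at most |C| vertices escape; since |C| ≥ 1 (connectivity) and
-- |V₀| > 2|C| ≥ |C| + 1, some w ≠ c does not escape.  The trail of w then stays inside V₀,
-- uses distinct edges, returns to w, and is nonempty (w lies on an edge), so it contains a
-- cycle of the forest: a contradiction.

open import Defs
open import Data.Nat using (ℕ; _<_; _≤_; _*_)
open import Data.List using (List; length)
open import Data.Fin.Subset using (Subset; ∁; ∣_∣)
open import Relation.Nullary using (¬_)

open import Data.Nat using (zero; suc; _+_; _%_; z≤n; s≤s)
import Data.Nat.Properties as ℕP
open import Algebra.Properties.CommutativeSemigroup ℕP.+-commutativeSemigroup using (interchange)
open import Data.Fin as Fin using (Fin; toℕ; inject₁; _≟_)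
import Data.Fin.Properties as FinP
import Data.Fin.Permutation.Components as PC
open import Data.Fin.Permutation using (Permutation′; id; transpose; _⟨$⟩ʳ_; _⟨$⟩ˡ_; inverseˡ)
open import Data.Fin.Subset using (inside; outside; Nonempty) renaming (_∈_ to _∈ₛ_; _∉_ to _∉ₛ_)
open import Data.Fin.Subset.Properties using (x∈∁p⇒x∉p; ∣p∣≤n) renaming (_∈?_ to _∈ₛ?_)
import Data.Vec.Base as Vec
open import Data.Vec.Base using ([]; _∷_)
open import Data.List using ([]; _∷_; _∷ʳ_; _++_; map; filter; allFin; cartesianProduct)
import Data.List.Properties as LP
open import Data.List.Membership.Propositional using (_∈_; lose)
open import Data.List.Membership.Propositional.Properties
  using (∈-map⁻; ∈-filter⁺; ∈-filter⁻; ∈-∃++; ∈-allFin; ∈-cartesianProduct⁺)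
open import Data.List.Relation.Unary.Any using (Any; here; there; any?)
open import Data.List.Relation.Unary.All as All using (All; []; _∷_)
open import Data.List.Relation.Unary.All.Properties as AllP using (¬Any⇒All¬)
open import Data.List.Relation.Unary.AllPairs using ([]; _∷_)
open import Data.List.Relation.Unary.Unique.Propositional using (Unique)
import Data.List.Relation.Unary.Unique.Propositional.Properties as UniqueP
open import Data.List.Relation.Unary.Linked using (Linked; []; [-]; _∷_)
open import Data.List.Relation.Binary.Permutation.Propositional using (_↭_; ↭-sym; ↭⇒↭ₛ)
open import Data.List.Relation.Binary.Permutation.Propositional.Properties
  using (∈-resp-↭; ↭-map-inv; filter-↭; ↭-length)
import Data.List.Relation.Binary.Permutation.Setoid.Properties as PermSetoidP
open import Data.Product using (_×_; _,_; ∃; ∃₂; proj₁; proj₂)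
open import Data.Sum using (_⊎_; inj₁; inj₂; map₂)
open import Data.Empty using (⊥; ⊥-elim)
open import Data.Unit using (⊤; tt)
open import Function.Base using (_∘′_)
open import Data.Bool using (true; false; if_then_else_)
open import Relation.Nullary using (Dec; yes; no; does)
open import Relation.Nullary.Decidable using (_×-dec_; _⊎-dec_; ¬?; toSum; dec-true; dec-false)
open import Relation.Unary using (Decidable)
open import Relation.Binary.PropositionalEquality
  using (_≡_; _≢_; refl; sym; trans; cong; cong₂; subst; subst₂; setoid; module ≡-Reasoning)
open import Relation.Binary.Construct.Closure.ReflexiveTransitive using (Star; ε; _◅_)

Touches : ∀ {n} → Edge n → Fin n → Set
Touches e p = proj₁ e ≡ p ⊎ proj₂ e ≡ p

touches? : ∀ {n} (e : Edge n) (p : Fin n) → Dec (Touches e p)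
touches? e p = (proj₁ e ≟ p) ⊎-dec (proj₂ e ≟ p)

Joins : ∀ {n} → Edge n → Fin n → Fin n → Set
Joins e x y = e ≡ (x , y) ⊎ e ≡ (y , x)

swap : ∀ {n} → Edge n → Fin n → Fin n
swap e p = edgePerm e ⟨$⟩ʳ p

transpose-left : ∀ {n} (i j : Fin n) → PC.transpose i j i ≡ j
transpose-left i j rewrite dec-true (i ≟ i) refl = refl

transpose-right : ∀ {n} (i j : Fin n) → PC.transpose i j j ≡ i
transpose-right i j with j ≟ i
... | yes j≡i = j≡i
... | no _ rewrite dec-true (j ≟ j) refl = refl

transpose-fixes : ∀ {n} {i j k : Fin n} → k ≢ i → k ≢ j → PC.transpose i j k ≡ k
transpose-fixes {i = i} {j} {k} k≢i k≢j rewrite dec-false (k ≟ i) k≢i | dec-false (k ≟ j) k≢j = refl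

swap-untouched : ∀ {n} (e : Edge n) {p} → ¬ Touches e p → swap e p ≡ p
swap-untouched e t = transpose-fixes (λ eq → t (inj₁ (sym eq))) (λ eq → t (inj₂ (sym eq)))

swap-joins : ∀ {n} (e : Edge n) {p} → Touches e p → Joins e p (swap e p)
swap-joins (x , y) (inj₁ refl) rewrite transpose-left x y = inj₁ refl
swap-joins (x , y) (inj₂ refl) rewrite transpose-right x y = inj₂ refl

swap-injective : ∀ {n} (e : Edge n) {p q} → swap e p ≡ swap e q → p ≡ q
swap-injective e {p} {q} eq = begin
  p                            ≡⟨ sym (inverseˡ (edgePerm e)) ⟩
  edgePerm e ⟨$⟩ˡ swap e p     ≡⟨ cong (edgePerm e ⟨$⟩ˡ_) eq ⟩
  edgePerm e ⟨$⟩ˡ swap e q     ≡⟨ inverseˡ (edgePerm e) ⟩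
  q                            ∎
  where open ≡-Reasoning

-- Following one vertex through a product of transpositions.

run : ∀ {n} → List (Edge n) → Fin n → Fin n
run []      p = p
run (e ∷ L) p = run L (swap e p)

run-○ : ∀ {n} (L : List (Edge n)) p → ○ (map edgePerm L) ⟨$⟩ʳ p ≡ run L p
run-○ []      p = refl
run-○ (e ∷ L) p = run-○ L (swap e p)

trail : ∀ {n} → List (Edge n) → Fin n → List (Edge n)
trail []      p = []
trail (e ∷ L) p with touches? e p
... | yes _ = e ∷ trail L (swap e p)
... | no  _ = trail L (swap e p)

data Walk {n} : Fin n → Fin n → List (Edge n) → Set where
  []  : ∀ {x} → Walk x x []
  _∷_ : ∀ {x y z e T} → Joins e x y → Walk y z T → Walk x z (e ∷ T)

trail-walk : ∀ {n} (L : List (Edge n)) p → Walk p (run L p) (trail L p)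
trail-walk []      p = []
trail-walk (e ∷ L) p with touches? e p
... | yes t = swap-joins e t ∷ trail-walk L (swap e p)
... | no ¬t = subst (λ x → Walk x (run L (swap e p)) (trail L (swap e p)))
                    (swap-untouched e ¬t) (trail-walk L (swap e p))

trail-⊆ : ∀ {n} (L : List (Edge n)) p {f} → f ∈ trail L p → f ∈ L
trail-⊆ (e ∷ L) p f∈ with touches? e p
trail-⊆ (e ∷ L) p (here f≡e)  | yes _ = here f≡e
trail-⊆ (e ∷ L) p (there f∈′) | yes _ = there (trail-⊆ L (swap e p) f∈′)
trail-⊆ (e ∷ L) p f∈          | no _  = there (trail-⊆ L (swap e p) f∈)

trail-unique : ∀ {n} (L : List (Edge n)) p → Unique L → Unique (trail L p)
trail-unique []      p _ = []
trail-unique (e ∷ L) p (e∉L ∷ uL) with touches? e p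
... | yes _ = All.tabulate (λ f∈ → All.lookup e∉L (trail-⊆ L (swap e p) f∈))
            ∷ trail-unique L (swap e p) uL
... | no _  = trail-unique L (swap e p) uL

touched⇒trail-nonempty : ∀ {n} {L : List (Edge n)} {e p} → e ∈ L → Touches e p → trail L p ≢ []
touched⇒trail-nonempty {L = f ∷ L} {p = p} e∈ t with touches? f p | e∈
... | yes _  | _ = λ ()
... | no ¬t′ | here refl = ⊥-elim (¬t′ t)
... | no ¬t′ | there e∈′ = touched⇒trail-nonempty e∈′ (subst (Touches _) (sym (swap-untouched f ¬t′)) t)

-- Closed trails of distinct edges contain cycles.

Oriented : ∀ {n} → Edge n → Set
Oriented e = proj₁ e Fin.< proj₂ e

joins-sym : ∀ {n} {e : Edge n} {x y} → Joins e x y → Joins e y x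
joins-sym (inj₁ eq) = inj₂ eq
joins-sym (inj₂ eq) = inj₁ eq

joins-irreflexive : ∀ {n} {e : Edge n} {x y} → Oriented e → Joins e x y → x ≢ y
joins-irreflexive o (inj₁ refl) = FinP.<⇒≢ o
joins-irreflexive o (inj₂ refl) = FinP.<⇒≢ o ∘′ sym

joins-unique : ∀ {n} {e f : Edge n} {x y} → Oriented e → Oriented f → Joins e x y → Joins f x y → e ≡ f
joins-unique _  _  (inj₁ refl) (inj₁ refl) = refl
joins-unique _  _  (inj₂ refl) (inj₂ refl) = refl
joins-unique oe of (inj₁ refl) (inj₂ refl) = ⊥-elim (ℕP.<-asym oe of)
joins-unique oe of (inj₂ refl) (inj₁ refl) = ⊥-elim (ℕP.<-asym oe of)

joins⇒adj : ∀ {n} {G : List (Edge n)} {e x y} → e ∈ G → Joins e x y → Adj G x y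
joins⇒adj e∈ (inj₁ refl) = inj₁ e∈
joins⇒adj e∈ (inj₂ refl) = inj₂ e∈

-- Cutting a list just after an entry d preserves All, Unique and Linked; these cut a path
-- at a repeated vertex.
all-prefix : ∀ {A : Set} {P : A → Set} (xs : List A) {d zs} → All P (xs ++ d ∷ zs) → All P (xs ∷ʳ d)
all-prefix xs ps = AllP.++⁺ (AllP.++⁻ˡ xs ps) (All.head (AllP.++⁻ʳ xs ps) ∷ [])

unique-prefix : ∀ {A : Set} (xs : List A) {d zs} → Unique (xs ++ d ∷ zs) → Unique (xs ∷ʳ d)
unique-prefix []       _        = [] ∷ []
unique-prefix (x ∷ xs) (x∉ ∷ u) = all-prefix xs x∉ ∷ unique-prefix xs u

linked-prefix : ∀ {A : Set} {R : A → A → Set} (xs : List A) {d zs} →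
                Linked R (xs ++ d ∷ zs) → Linked R (xs ∷ʳ d)
linked-prefix []           _       = [-]
linked-prefix (x ∷ [])     (r ∷ _) = r ∷ [-]
linked-prefix (x ∷ y ∷ xs) (r ∷ l) = r ∷ linked-prefix (y ∷ xs) l

linked-snoc : ∀ {A : Set} {R : A → A → Set} (xs : List A) {d e} →
              Linked R (xs ∷ʳ d) → R d e → Linked R (xs ∷ʳ d ∷ʳ e)
linked-snoc []           _        r = r ∷ [-]
linked-snoc (x ∷ [])     (r₀ ∷ _) r = r₀ ∷ r ∷ [-]
linked-snoc (x ∷ y ∷ xs) (r₀ ∷ l) r = r₀ ∷ linked-snoc (y ∷ xs) l r

∷ʳ-nonempty : ∀ {A : Set} (xs : List A) d → 1 ≤ length (xs ∷ʳ d)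
∷ʳ-nonempty []      _ = s≤s z≤n
∷ʳ-nonempty (_ ∷ _) _ = s≤s z≤n

fresh-after : ∀ {n} {e : Edge n} {c d T} → Oriented e → Joins e c d → All (e ≢_) T → All Oriented T →
              All (λ f → ¬ Joins f d c) T
fresh-after oe j e∉T oT =
  All.zipWith (λ (e≢f , of) jf → e≢f (joins-unique oe of (joins-sym j) jf)) (e∉T , oT)

module TrailCycles {n} (G : List (Edge n)) where

  open import Data.List.Membership.DecPropositional (_≟_ {n}) using () renaming (_∈?_ to _∈ₗ?_)

  TrailEdges : List (Edge n) → Set
  TrailEdges T = Unique T × All Oriented T × All (_∈ G) T

  -- Follow the trail, keeping the path c ∷ s ∷ ps of distinct vertices visited so far
  -- (most recent first; it started at x₀).  The edge just traversed, from s to c, is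
  -- not among the remaining edges T.  The first revisit of a vertex closes a cycle;
  -- the trail cannot end first, since it ends at x₀.
  grow : ∀ {c x₀ T} s ps → Linked (Adj G) (c ∷ s ∷ ps) → Unique (c ∷ s ∷ ps) → x₀ ∈ s ∷ ps →
         All (λ f → ¬ Joins f c s) T → TrailEdges T → Walk c x₀ T → ∃₂ (Cycle G)
  grow _ _ _ (c∉ ∷ _) x₀∈ _ _ [] = ⊥-elim (All.lookup c∉ x₀∈ refl)
  grow {c} s ps path uniq x₀∈ (¬back ∷ _) (e∉T ∷ uT , oe ∷ oT , e∈G ∷ gT) (_∷_ {y = d} j walk)
    with d ∈ₗ? (c ∷ s ∷ ps)
  ... | yes (here refl)         = ⊥-elim (joins-irreflexive oe j refl)
  ... | yes (there (here refl)) = ⊥-elim (¬back j)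
  ... | yes (there (there d∈ps)) with ∈-∃++ d∈ps
  ...   | qs , zs , refl =
          c , s ∷ qs ∷ʳ d , s≤s (∷ʳ-nonempty qs d) , unique-prefix (c ∷ s ∷ qs) uniq ,
          linked-snoc (c ∷ s ∷ qs) (linked-prefix (c ∷ s ∷ qs) path) (joins⇒adj e∈G (joins-sym j))
  grow {c} s ps path uniq x₀∈ _ (e∉T ∷ uT , oe ∷ oT , e∈G ∷ gT) (j ∷ walk) | no d∉ =
          grow c (s ∷ ps) (joins⇒adj e∈G (joins-sym j) ∷ path) (¬Any⇒All¬ _ d∉ ∷ uniq) (there x₀∈)
               (fresh-after oe j e∉T oT) (uT , oT , gT) walk

  closed-trail⇒cycle : ∀ {w T} → T ≢ [] → TrailEdges T → Walk w w T → ∃₂ (Cycle G)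
  closed-trail⇒cycle T≢[] _ [] = ⊥-elim (T≢[] refl)
  closed-trail⇒cycle _ (e∉T ∷ uT , oe ∷ oT , e∈G ∷ gT) (j ∷ walk) =
    grow _ [] (joins⇒adj e∈G (joins-sym j) ∷ [-]) ((joins-irreflexive oe (joins-sym j) ∷ []) ∷ [] ∷ [])
         (here refl) (fresh-after oe j e∉T oT) (uT , oT , gT) walk

-- Counting the entries of a list that satisfy a decidable predicate.

count : ∀ {A : Set} {P : A → Set} → Decidable P → List A → ℕ
count P? xs = length (filter P? xs)

indicator : ∀ {P : Set} → Dec P → ℕ
indicator P? = if does P? then 1 else 0

count-∷ : ∀ {A : Set} {P : A → Set} (P? : Decidable P) x xs →
          count P? (x ∷ xs) ≡ indicator (P? x) + count P? xs
count-∷ P? x xs with does (P? x)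
... | true  = refl
... | false = refl

count-split : ∀ {A : Set} {P Q R : A → Set} (P? : Decidable P) (Q? : Decidable Q) (R? : Decidable R) xs →
              (∀ {x} → x ∈ xs → P x → Q x ⊎ R x) → count P? xs ≤ count Q? xs + count R? xs
count-split P? Q? R? []       _ = z≤n
count-split P? Q? R? (x ∷ xs) h = begin
  count P? (x ∷ xs)
    ≡⟨ count-∷ P? x xs ⟩
  indicator (P? x) + count P? xs
    ≤⟨ ℕP.+-mono-≤ (pointwise (P? x) (Q? x) (R? x) (h (here refl)))
                   (count-split P? Q? R? xs (h ∘′ there)) ⟩
  (indicator (Q? x) + indicator (R? x)) + (count Q? xs + count R? xs)
    ≡⟨ interchange (indicator (Q? x)) _ _ _ ⟩
  (indicator (Q? x) + count Q? xs) + (indicator (R? x) + count R? xs)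
    ≡⟨ cong₂ _+_ (count-∷ Q? x xs) (count-∷ R? x xs) ⟨
  count Q? (x ∷ xs) + count R? (x ∷ xs)
    ∎
  where
  open ℕP.≤-Reasoning
  pointwise : ∀ {P Q R : Set} (P? : Dec P) (Q? : Dec Q) (R? : Dec R) → (P → Q ⊎ R) →
              indicator P? ≤ indicator Q? + indicator R?
  pointwise (no _)  _       _       _ = z≤n
  pointwise (yes _) (yes _) _       _ = s≤s z≤n
  pointwise (yes _) (no _)  (yes _) _ = s≤s z≤n
  pointwise (yes p) (no ¬q) (no ¬r) h with h p
  ... | inj₁ q = ⊥-elim (¬q q)
  ... | inj₂ r = ⊥-elim (¬r r)

count-map : ∀ {A B : Set} {P : A → Set} {Q : B → Set} (P? : Decidable P) (Q? : Decidable Q) (f : A → B) xs →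
            (∀ {x} → x ∈ xs → P x → Q (f x)) → count P? xs ≤ count Q? (map f xs)
count-map P? Q? f []       _ = z≤n
count-map P? Q? f (x ∷ xs) h = begin
  count P? (x ∷ xs)
    ≡⟨ count-∷ P? x xs ⟩
  indicator (P? x) + count P? xs
    ≤⟨ ℕP.+-mono-≤ (pointwise (P? x) (Q? (f x)) (h (here refl))) (count-map P? Q? f xs (h ∘′ there)) ⟩
  indicator (Q? (f x)) + count Q? (map f xs)
    ≡⟨ count-∷ Q? (f x) (map f xs) ⟨
  count Q? (map f (x ∷ xs))
    ∎
  where
  open ℕP.≤-Reasoning
  pointwise : ∀ {P Q : Set} (P? : Dec P) (Q? : Dec Q) → (P → Q) → indicator P? ≤ indicator Q?
  pointwise (no _)  _      _ = z≤n
  pointwise (yes _) (yes _) _ = s≤s z≤n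
  pointwise (yes p) (no ¬q) h = ⊥-elim (¬q (h p))

count-≤1 : ∀ {A : Set} {P : A → Set} (P? : Decidable P) {xs} → Unique xs →
           (∀ {x y} → x ∈ xs → y ∈ xs → P x → P y → x ≡ y) → count P? xs ≤ 1
count-≤1 {P = P} P? {xs} u one with filter P? xs in eq | UniqueP.filter⁺ P? u
... | []        | _ = z≤n
... | _ ∷ []    | _ = s≤s z≤n
... | a ∷ b ∷ rest | (a≢b ∷ _) ∷ _ =
  ⊥-elim (a≢b (same (from-filter (here refl)) (from-filter (there (here refl)))))
  where
  from-filter : ∀ {x} → x ∈ a ∷ b ∷ rest → x ∈ xs × P x
  from-filter x∈ = ∈-filter⁻ P? {xs = xs} (subst (_ ∈_) (sym eq) x∈)
  same : ∀ {x y} → x ∈ xs × P x → y ∈ xs × P y → x ≡ y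
  same (x∈ , px) (y∈ , py) = one x∈ y∈ px py

count-exists : ∀ {A : Set} {P : A → Set} (P? : Decidable P) xs → 1 ≤ count P? xs → ∃ λ x → x ∈ xs × P x
count-exists P? xs pos with filter P? xs in eq
... | []    = ⊥-elim (ℕP.n≮0 pos)
... | a ∷ _ = a , ∈-filter⁻ P? (subst (a ∈_) (sym eq) (here refl))

length-cover : ∀ {A : Set} {Q R : A → Set} (Q? : Decidable Q) (R? : Decidable R) xs →
               (∀ {x} → x ∈ xs → Q x ⊎ R x) → length xs ≤ count Q? xs + count R? xs
length-cover {A} Q? R? xs h =
  subst (_≤ count Q? xs + count R? xs) (cong length (LP.filter-all always {xs} (All.tabulate (λ _ → tt))))
        (count-split always Q? R? xs (λ x∈ _ → h x∈))
  where
  always : Decidable {A = A} (λ _ → ⊤)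
  always _ = yes tt

count-≥1 : ∀ {A : Set} {P : A → Set} (P? : Decidable P) {xs x} → x ∈ xs → P x → 1 ≤ count P? xs
count-≥1 P? x∈ px = LP.filter-some P? (lose x∈ px)

-- Parity of the identity and of a transposition of two consecutive points.

inversion? : ∀ {n} (π : Permutation′ n) →
             Decidable (λ (p : Fin n × Fin n) →
                          proj₁ p Fin.< proj₂ p × π ⟨$⟩ʳ proj₂ p Fin.< π ⟨$⟩ʳ proj₁ p)
inversion? π p = (proj₁ p Fin.<? proj₂ p) ×-dec (π ⟨$⟩ʳ proj₂ p Fin.<? π ⟨$⟩ʳ proj₁ p)

orderedPairs : ∀ n → List (Fin n × Fin n)
orderedPairs n = cartesianProduct (allFin n) (allFin n)

id-even : ∀ {n} → InAlt {n} id
id-even {n} = cong (λ k → length k % 2)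
  (LP.filter-none (inversion? id) {orderedPairs n} (All.tabulate λ _ (i<j , j<i) → ℕP.<-asym i<j j<i))

transpose-place : ∀ {n} (a b x : Fin n) → x ≡ a ⊎ x ≡ b ⊎ (x ≢ a × x ≢ b)
transpose-place a b x with x ≟ a | x ≟ b
... | yes x≡a | _       = inj₁ x≡a
... | no _    | yes x≡b = inj₂ (inj₁ x≡b)
... | no x≢a  | no x≢b  = inj₂ (inj₂ (x≢a , x≢b))

adjacent-< : ∀ {n} {a b : Fin n} → toℕ b ≡ suc (toℕ a) → a Fin.< b
adjacent-< {a = a} b≡a+1 = subst (toℕ a <_) (sym b≡a+1) (ℕP.n<1+n (toℕ a))

nothing-between : ∀ {n} {a b x : Fin n} → toℕ b ≡ suc (toℕ a) → a Fin.< x → x Fin.< b → ⊥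
nothing-between b≡a+1 a<x x<b = ℕP.<⇒≱ a<x (ℕP.≤-pred (subst (toℕ _ <_) b≡a+1 x<b))

adjacent-inversion : ∀ {n} {a b i j : Fin n} → toℕ b ≡ suc (toℕ a) →
                     i Fin.< j → PC.transpose a b j Fin.< PC.transpose a b i → (i , j) ≡ (a , b)
adjacent-inversion {a = a} {b} {i} {j} b≡a+1 i<j inv
  with transpose-place a b i | transpose-place a b j
... | inj₁ refl        | inj₁ refl        = ⊥-elim (ℕP.<-irrefl refl i<j)
... | inj₁ refl        | inj₂ (inj₁ refl) = refl
... | inj₁ refl        | inj₂ (inj₂ (j≢a , j≢b)) =
  ⊥-elim (nothing-between b≡a+1 i<j (subst₂ Fin._<_ (transpose-fixes j≢a j≢b) (transpose-left a b) inv))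
... | inj₂ (inj₁ refl) | inj₁ refl        = ⊥-elim (ℕP.<-asym i<j (adjacent-< b≡a+1))
... | inj₂ (inj₁ refl) | inj₂ (inj₁ refl) = ⊥-elim (ℕP.<-irrefl refl i<j)
... | inj₂ (inj₁ refl) | inj₂ (inj₂ (j≢a , j≢b)) =
  ⊥-elim (ℕP.<-asym (ℕP.<-trans (adjacent-< b≡a+1) i<j)
                    (subst₂ Fin._<_ (transpose-fixes j≢a j≢b) (transpose-right a b) inv))
... | inj₂ (inj₂ (i≢a , i≢b)) | inj₁ refl =
  ⊥-elim (ℕP.<-asym (ℕP.<-trans i<j (adjacent-< b≡a+1))
                    (subst₂ Fin._<_ (transpose-left a b) (transpose-fixes i≢a i≢b) inv))
... | inj₂ (inj₂ (i≢a , i≢b)) | inj₂ (inj₁ refl) =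
  ⊥-elim (nothing-between b≡a+1 (subst₂ Fin._<_ (transpose-right a b) (transpose-fixes i≢a i≢b) inv) i<j)
... | inj₂ (inj₂ (i≢a , i≢b)) | inj₂ (inj₂ (j≢a , j≢b)) =
  ⊥-elim (ℕP.<-asym i<j (subst₂ Fin._<_ (transpose-fixes j≢a j≢b) (transpose-fixes i≢a i≢b) inv))
adjacent-odd : ∀ {n} {a b : Fin n} → toℕ b ≡ suc (toℕ a) → ¬ InAlt (transpose a b)
adjacent-odd {n} {a} {b} b≡a+1 even = ℕP.1+n≢0 (subst (λ k → k % 2 ≡ 0) one-inversion even)
  where
  a<b : a Fin.< b
  a<b = adjacent-< b≡a+1
  one-inversion : inversions (transpose a b) ≡ 1
  one-inversion = ℕP.≤-antisym
    (count-≤1 (inversion? (transpose a b))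
              (UniqueP.cartesianProduct⁺ (UniqueP.allFin⁺ n) (UniqueP.allFin⁺ n))
              (λ _ _ (i<j , inv) (k<l , inv′) → trans (adjacent-inversion b≡a+1 i<j inv)
                                                       (sym (adjacent-inversion b≡a+1 k<l inv′))))
    (count-≥1 (inversion? (transpose a b)) (∈-cartesianProduct⁺ (∈-allFin a) (∈-allFin b))
              (a<b , subst₂ Fin._<_ (sym (transpose-right a b)) (sym (transpose-left a b)) a<b))

elements : ∀ {n} → Subset n → List (Fin n)
elements []            = []
elements (inside  ∷ p) = Fin.zero ∷ map Fin.suc (elements p)
elements (outside ∷ p) = map Fin.suc (elements p)

elements-length : ∀ {n} (p : Subset n) → length (elements p) ≡ ∣ p ∣
elements-length []            = refl
elements-length (inside  ∷ p) = cong suc (trans (LP.length-map Fin.suc (elements p)) (elements-length p))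
elements-length (outside ∷ p) = trans (LP.length-map Fin.suc (elements p)) (elements-length p)

elements-∈ : ∀ {n} (p : Subset n) {x} → x ∈ elements p → x ∈ₛ p
elements-∈ (inside ∷ p) (here refl) = Vec.here
elements-∈ (inside ∷ p) (there x∈) with ∈-map⁻ Fin.suc x∈
... | _ , y∈ , refl = Vec.there (elements-∈ p y∈)
elements-∈ (outside ∷ p) x∈ with ∈-map⁻ Fin.suc x∈
... | _ , y∈ , refl = Vec.there (elements-∈ p y∈)

elements-unique : ∀ {n} (p : Subset n) → Unique (elements p)
elements-unique []            = []
elements-unique (inside  ∷ p) =
  AllP.map⁺ (All.tabulate (λ _ ())) ∷ UniqueP.map⁺ FinP.suc-injective (elements-unique p)
elements-unique (outside ∷ p) = UniqueP.map⁺ FinP.suc-injective (elements-unique p)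

inhabited : ∀ {n} (p : Subset n) → 1 ≤ ∣ p ∣ → Nonempty p
inhabited p 1≤∣p∣ with elements p | elements-length p | elements-∈ p
... | x ∷ _ | _ | ∈p = x , ∈p (here refl)
... | []    | 0≡∣p∣ | _ = ⊥-elim (ℕP.n≮0 (subst (1 ≤_) (sym 0≡∣p∣) 1≤∣p∣))

-- Trails relative to the partition of the vertices into V₀ and its complement.

module Partition {n} (V₀ : Subset n) where

  Crossing : Edge n → Set
  Crossing e = (proj₁ e ∈ₛ V₀ × proj₂ e ∉ₛ V₀) ⊎ (proj₁ e ∉ₛ V₀ × proj₂ e ∈ₛ V₀)

  crossing? : Decidable Crossing
  crossing? e = ((proj₁ e ∈ₛ? V₀) ×-dec ¬? (proj₂ e ∈ₛ? V₀))
          ⊎-dec (¬? (proj₁ e ∈ₛ? V₀) ×-dec (proj₂ e ∈ₛ? V₀))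

  Internal : Edge n → Set
  Internal e = proj₁ e ∈ₛ V₀ × proj₂ e ∈ₛ V₀

  internal? : Decidable Internal
  internal? e = (proj₁ e ∈ₛ? V₀) ×-dec (proj₂ e ∈ₛ? V₀)

  noncrossing-internal : ∀ {e p} → ¬ Crossing e → Touches e p → p ∈ₛ V₀ → Internal e
  noncrossing-internal {e} ¬cr (inj₁ refl) p∈ with proj₂ e ∈ₛ? V₀
  ... | yes q∈ = p∈ , q∈
  ... | no q∉  = ⊥-elim (¬cr (inj₁ (p∈ , q∉)))
  noncrossing-internal {e} ¬cr (inj₂ refl) p∈ with proj₁ e ∈ₛ? V₀
  ... | yes q∈ = q∈ , p∈
  ... | no q∉  = ⊥-elim (¬cr (inj₂ (q∉ , p∈)))

  noncrossing-preserves : ∀ {e p} → ¬ Crossing e → p ∈ₛ V₀ → swap e p ∈ₛ V₀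
  noncrossing-preserves {e} {p} ¬cr p∈ with touches? e p
  ... | no ¬t = subst (_∈ₛ V₀) (sym (swap-untouched e ¬t)) p∈
  ... | yes t with swap-joins e t | noncrossing-internal ¬cr t p∈
  ...   | inj₁ e≡ | _ , q∈ = subst (_∈ₛ V₀) (cong proj₂ e≡) q∈
  ...   | inj₂ e≡ | q∈ , _ = subst (_∈ₛ V₀) (cong proj₁ e≡) q∈

  crossing-end-unique : ∀ {e p q} → Crossing e → Touches e p → Touches e q → p ∈ₛ V₀ → q ∈ₛ V₀ → p ≡ q
  crossing-end-unique {e} cr tp tq p∈ q∈ = trans (inner cr tp p∈) (sym (inner cr tq q∈))
    where
    inner-end : Crossing e → Fin n
    inner-end (inj₁ _) = proj₁ e
    inner-end (inj₂ _) = proj₂ e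
    inner : ∀ {x} (cr : Crossing e) → Touches e x → x ∈ₛ V₀ → x ≡ inner-end cr
    inner (inj₁ _)         (inj₁ refl) _  = refl
    inner (inj₁ (_ , y∉)) (inj₂ refl) x∈ = ⊥-elim (y∉ x∈)
    inner (inj₂ (y∉ , _)) (inj₁ refl) x∈ = ⊥-elim (y∉ x∈)
    inner (inj₂ _)         (inj₂ refl) _  = refl

  Escapes : List (Edge n) → Fin n → Set
  Escapes L p = Any Crossing (trail L p)

  escapes? : (L : List (Edge n)) → Decidable (Escapes L)
  escapes? L p = any? crossing? (trail L p)

  escapes-crossing-step : ∀ {e} L {p} → Escapes (e ∷ L) p → Touches e p ⊎ Escapes L p
  escapes-crossing-step {e} L {p} esc with touches? e p
  ... | yes t  = inj₁ t
  ... | no ¬t = inj₂ (subst (Escapes L) (swap-untouched e ¬t) esc)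

  escapes-noncrossing-step : ∀ {e} L {p} → ¬ Crossing e → Escapes (e ∷ L) p → Escapes L (swap e p)
  escapes-noncrossing-step {e} L {p} ¬cr esc with touches? e p
  escapes-noncrossing-step L ¬cr (here cr)    | yes _ = ⊥-elim (¬cr cr)
  escapes-noncrossing-step L ¬cr (there esc′) | yes _ = esc′
  escapes-noncrossing-step L ¬cr esc          | no _  = esc

  -- A crossing edge lets at most one vertex of V₀ escape at the moment it
  -- acts; a non-crossing edge merely permutes the vertices of V₀ that are still inside.
  escaping-count : ∀ L W → All (_∈ₛ V₀) W → Unique W → count (escapes? L) W ≤ count crossing? L
  escaping-count [] W _ _ =
    ℕP.≤-reflexive (cong length (LP.filter-none (escapes? []) {W} (All.tabulate λ _ ())))
  escaping-count (e ∷ L) W inV₀ uW with crossing? e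
  ... | yes cr = begin
    count (escapes? (e ∷ L)) W
      ≤⟨ count-split (escapes? (e ∷ L)) (touches? e) (escapes? L) W (λ _ → escapes-crossing-step L) ⟩
    count (touches? e) W + count (escapes? L) W
      ≤⟨ ℕP.+-mono-≤ (count-≤1 (touches? e) uW one-end) (escaping-count L W inV₀ uW) ⟩
    1 + count crossing? L
      ≡⟨ cong length (LP.filter-accept crossing? {xs = L} cr) ⟨
    count crossing? (e ∷ L)
      ∎
    where
    open ℕP.≤-Reasoning
    one-end : ∀ {x y} → x ∈ W → y ∈ W → Touches e x → Touches e y → x ≡ y
    one-end x∈ y∈ tx ty = crossing-end-unique cr tx ty (All.lookup inV₀ x∈) (All.lookup inV₀ y∈)
  ... | no ¬cr = begin
    count (escapes? (e ∷ L)) W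
      ≤⟨ count-map (escapes? (e ∷ L)) (escapes? L) (swap e) W (λ _ → escapes-noncrossing-step L ¬cr) ⟩
    count (escapes? L) (map (swap e) W)
      ≤⟨ escaping-count L (map (swap e) W) (AllP.map⁺ (All.map (noncrossing-preserves ¬cr) inV₀))
                                           (UniqueP.map⁺ (swap-injective e) uW) ⟩
    count crossing? L
      ≡⟨ cong length (LP.filter-reject crossing? {xs = L} ¬cr) ⟨
    count crossing? (e ∷ L)
      ∎
    where open ℕP.≤-Reasoning

  internal-trail : ∀ L {p} → p ∈ₛ V₀ → ¬ Escapes L p → All Internal (trail L p)
  internal-trail []      _  _    = []
  internal-trail (e ∷ L) {p} p∈ ¬esc with touches? e p
  ... | yes t  = noncrossing-internal (¬esc ∘′ here) t p∈
                 ∷ internal-trail L (noncrossing-preserves (¬esc ∘′ here) p∈) (¬esc ∘′ there)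
  ... | no ¬t = internal-trail L (subst (_∈ₛ V₀) (sym (swap-untouched e ¬t)) p∈) ¬esc

  crossing-on-path : ∀ {E : List (Edge n)} {x y} →
                     Star (Adj E) x y → x ∈ₛ V₀ → y ∉ₛ V₀ → 1 ≤ count crossing? E
  crossing-on-path ε x∈ y∉ = ⊥-elim (y∉ x∈)
  crossing-on-path (_◅_ {j = u} adj path) x∈ y∉ with u ∈ₛ? V₀ | adj
  ... | yes u∈ | _        = crossing-on-path path u∈ y∉
  ... | no u∉  | inj₁ e∈ = count-≥1 crossing? e∈ (inj₁ (x∈ , u∉))
  ... | no u∉  | inj₂ e∈ = count-≥1 crossing? e∈ (inj₂ (u∉ , x∈))

touched-on-path : ∀ {n} {E : List (Edge n)} {x y} →
                  Star (Adj E) x y → x ≢ y → ∃ λ e → e ∈ E × Touches e x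
touched-on-path ε             x≢x = ⊥-elim (x≢x refl)
touched-on-path (inj₁ e∈ ◅ _) _   = _ , e∈ , inj₁ refl
touched-on-path (inj₂ e∈ ◅ _) _   = _ , e∈ , inj₂ refl

surplus : ∀ C V g → 2 * C < V → V ≤ C + (1 + g) → C ≤ g
surplus C V g 2C<V V≤ = ℕP.≤-pred (ℕP.+-cancelˡ-≤ C (suc C) (suc g) (begin
  C + suc C         ≡⟨ ℕP.+-suc C C ⟩
  suc (C + C)       ≡⟨ cong (λ k → suc (C + k)) (ℕP.+-identityʳ C) ⟨
  suc (2 * C)       ≤⟨ 2C<V ⟩
  V                 ≤⟨ V≤ ⟩
  C + suc g         ∎))
  where open ℕP.≤-Reasoning

module NoFixingProduct {n} (E : List (Edge n)) (V₀ : Subset n)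
                       (simple : SimpleGraph E) (connected : Connected E)
                       (forest : Forest (inducedEdges V₀ E))
                       (few-crossing : 2 * length (crossEdges V₀ E) < ∣ V₀ ∣)
                       {b : Fin n} (b∉ : b ∉ₛ V₀) where

  open Partition V₀
  open TrailCycles (inducedEdges V₀ E)

  -- A vertex of V₀ that never escapes does not return: its trail would be a nonempty
  -- closed trail inside V₀ (nonempty, since w is joined to b), hence contain a cycle of
  -- the forest.
  non-escaping-vertex-moves : ∀ {L} → E ↭ L → ∀ {w} → w ∈ₛ V₀ → ¬ Escapes L w → run L w ≢ w
  non-escaping-vertex-moves {L} E↭L {w} w∈ ¬esc returns =
    let y , vs , cycle = closed-trail⇒cycle nonempty (unique , oriented , induced) closed-walk
    in forest y vs cycle
    where
    touching : ∃ λ e → e ∈ E × Touches e w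
    touching = touched-on-path (connected w b) (λ w≡b → b∉ (subst (_∈ₛ V₀) w≡b w∈))
    nonempty : trail L w ≢ []
    nonempty = touched⇒trail-nonempty (∈-resp-↭ E↭L (proj₁ (proj₂ touching))) (proj₂ (proj₂ touching))
    in-E : All (_∈ E) (trail L w)
    in-E = All.tabulate (∈-resp-↭ (↭-sym E↭L) ∘′ trail-⊆ L w)
    unique : Unique (trail L w)
    unique = trail-unique L w (PermSetoidP.Unique-resp-↭ (setoid (Edge n)) (↭⇒↭ₛ E↭L) (proj₂ simple))
    oriented : All Oriented (trail L w)
    oriented = All.map (All.lookup (proj₁ simple)) in-E
    induced : All (_∈ inducedEdges V₀ E) (trail L w)
    induced = All.zipWith (λ (e∈ , int) → ∈-filter⁺ internal? e∈ int) (in-E , internal-trail L w∈ ¬esc)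
    closed-walk : Walk w w (trail L w)
    closed-walk = subst (λ z → Walk w z (trail L w)) returns (trail-walk L w)

  -- Counting: more than 2|C| vertices in V₀, at most |C| of them escape and one is c.
  good-vertex : ∀ {L} → E ↭ L → (c : Fin n) → ∃ λ w → w ∈ₛ V₀ × w ≢ c × ¬ Escapes L w
  good-vertex {L} E↭L c
    with count-exists good? W (ℕP.≤-trans C≥1 (surplus C ∣ V₀ ∣ _ few-crossing cover))
    where
    W : List (Fin n)
    W = elements V₀
    C : ℕ
    C = count crossing? E
    C≥1 : 1 ≤ C
    C≥1 = let x₀ , x₀∈ = inhabited V₀ (ℕP.≤-trans (s≤s z≤n) few-crossing)
          in crossing-on-path (connected x₀ b) x₀∈ b∉
    stays? : Decidable (λ v → ¬ Escapes L v)
    stays? v = ¬? (escapes? L v)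
    good? : Decidable (λ v → ¬ Escapes L v × v ≢ c)
    good? v = ¬? (escapes? L v) ×-dec ¬? (v ≟ c)
    escaping : count (escapes? L) W ≤ C
    escaping = subst (count (escapes? L) W ≤_) (↭-length (filter-↭ crossing? (↭-sym E↭L)))
                     (escaping-count L W (All.tabulate (elements-∈ V₀)) (elements-unique V₀))
    at-c : count (_≟ c) W ≤ 1
    at-c = count-≤1 (_≟ c) (elements-unique V₀) (λ _ _ x≡c y≡c → trans x≡c (sym y≡c))
    cover : ∣ V₀ ∣ ≤ C + (1 + count good? W)
    cover = begin
      ∣ V₀ ∣
        ≡⟨ elements-length V₀ ⟨
      length W
        ≤⟨ length-cover (escapes? L) stays? W (λ {v} _ → toSum (escapes? L v)) ⟩
      count (escapes? L) W + count stays? W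
        ≤⟨ ℕP.+-mono-≤ escaping (count-split stays? (_≟ c) good? W
                                               (λ {v} _ ¬esc → map₂ (¬esc ,_) (toSum (v ≟ c)))) ⟩
      C + (count (_≟ c) W + count good? W)
        ≤⟨ ℕP.+-monoʳ-≤ C (ℕP.+-monoˡ-≤ (count good? W) at-c) ⟩
      C + (1 + count good? W)
        ∎
      where open ℕP.≤-Reasoning
  ... | w , w∈W , ¬esc , w≢c = w , elements-∈ V₀ w∈W , w≢c , ¬esc

  no-fixing-product : ∀ (π : Permutation′ n) c → (∀ v → v ∈ₛ V₀ → v ≢ c → π ⟨$⟩ʳ v ≡ v) →
                      ¬ InProd (map edgePerm E) π
  no-fixing-product π c fixes (r , r↭ , r≈π) with ↭-map-inv edgePerm (↭-sym r↭)
  ... | L , refl , E↭L =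
    let w , w∈ , w≢c , ¬esc = good-vertex E↭L c
    in non-escaping-vertex-moves E↭L w∈ ¬esc (trans (sym (run-○ L w)) (trans (r≈π w) (fixes w w∈ w≢c)))

odd-transposition-at : ∀ {m} (b : Fin (suc (suc m))) →
  ∃₂ λ c (τ : Permutation′ (suc (suc m))) → ¬ InAlt τ × (∀ v → v ≢ b → v ≢ c → τ ⟨$⟩ʳ v ≡ v)
odd-transposition-at {m} Fin.zero =
  Fin.suc Fin.zero , transpose Fin.zero (Fin.suc Fin.zero) ,
  adjacent-odd {suc (suc m)} {Fin.zero} {Fin.suc Fin.zero} refl ,
  λ _ v≢b v≢c → transpose-fixes v≢b v≢c
odd-transposition-at (Fin.suc k) =
  inject₁ k , transpose (inject₁ k) (Fin.suc k) , adjacent-odd (cong suc (sym (FinP.toℕ-inject₁ k))) ,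
  λ _ v≢b v≢c → transpose-fixes v≢c v≢b

theorem2p5 : (n : ℕ) (E : List (Edge n)) → SimpleGraph E → Connected E →
    (V₀ : Subset n) →
    Forest (inducedEdges V₀ E) →
    2 * length (crossEdges V₀ E) < ∣ V₀ ∣ →
    2 ≤ ∣ ∁ V₀ ∣ →
    ¬ PermCompleteGraph E
theorem2p5 zero       _ _ _ V₀ _ _ 2≤∣V₁∣ with ℕP.≤-trans 2≤∣V₁∣ (∣p∣≤n (∁ V₀))
... | ()
theorem2p5 (suc zero) _ _ _ V₀ _ _ 2≤∣V₁∣ with ℕP.≤-trans 2≤∣V₁∣ (∣p∣≤n (∁ V₀))
... | s≤s ()
theorem2p5 (suc (suc m)) E simple connected V₀ forest few-crossing 2≤∣V₁∣ =
  let b , b∈V₁ = inhabited (∁ V₀) (ℕP.≤-trans (s≤s z≤n) 2≤∣V₁∣)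
      b∉V₀ = x∈∁p⇒x∉p b∈V₁
      c , τ , τ-odd , τ-fixes = odd-transposition-at b
      open NoFixingProduct E V₀ simple connected forest few-crossing b∉V₀
      τ-fixes-V₀ : ∀ v → v ∈ₛ V₀ → v ≢ c → τ ⟨$⟩ʳ v ≡ v
      τ-fixes-V₀ v v∈ = τ-fixes v (λ v≡b → b∉V₀ (subst (_∈ₛ V₀) v≡b v∈))
  in λ { (inj₁ Prod≡Alt) → no-fixing-product id c (λ _ _ _ → refl)
                                               (proj₂ (Prod≡Alt id) (id-even {suc (suc m)}))
       ; (inj₂ Prod≡Odd) → no-fixing-product τ c τ-fixes-V₀ (proj₂ (Prod≡Odd τ) τ-odd) }
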